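{- Let $k,l$ be positive integers and let $M$ be a matroid with Tutte polynomial $T_M(x,y)=\sum_{i,j\ge 0}t_{i,j}x^iy^j$. Then $M$ is $(k,l)$-uniform if and only if $t_{i,j}=0$ for all pairs $(i,j)$ with $i\ge k$ and $j\ge l$.
   Context: For positive integers $k,l$, a matroid is called $(k,l)$-uniform if it has no minor isomorphic to $U_{k,k}\oplus U_{0,l}$ (the matroid consisting of $k$ coloops and $l$ loops). The Tutte polynomial of $M$ is $T_M(x,y)=\sum_B x^{\mathrm{int}(B)}y^{\mathrm{ext}(B)}$, the sum over all bases $B$ of $M$, where for a fixed total order on the ground set, $\mathrm{int}(B)$ is the number of $v\in B$ that are the smallest element of the unique cocircuit contained in $(E-B)\cup\{v\}$, and $\mathrm{ext}(B)$ is the number of $v\notin B$ that are the smallest element of the unique circuit contained in $B\cup\{v\}$; this polynomial is independent of the order. Thus $t_{i,j}$ is the number of bases with internal activity $i$ and external activity $j$. -}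

module Defs where

open import Data.Nat as ℕ using (ℕ; zero; suc; _+_; _≤_; _<_; _≡ᵇ_)
open import Data.Bool using (Bool; true; false; _∧_; if_then_else_)
open import Data.Fin as Fin using (Fin)
open import Data.Fin.Properties using (all?)
import Data.Fin.Properties as FinP
open import Data.Fin.Subset
  using (Subset; inside; outside; _∈_; _∉_; _⊆_; _⊂_; ⁅_⁆; _∪_; _∩_; ∁; ∣_∣)
  renaming (⊥ to ∅)
open import Data.Fin.Subset.Properties using (_∈?_; _⊆?_; _⊂?_; anySubset?)
open import Data.Vec using (Vec; []; _∷_; tabulate; lookup; take; drop)
open import Data.Product using (Σ; ∃; ∃-syntax; _×_; _,_)
open import Function using (_∘_)
open import Function.Definitions using (Injective)
open import Function.Bundles using (_⇔_)
open import Relation.Binary.PropositionalEquality using (_≡_)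
open import Relation.Nullary using (¬_; Dec; yes; no; does)
open import Relation.Nullary.Decidable using (_×-dec_; _→-dec_; ¬?; decidable-stable)
open import Relation.Unary using (Decidable)

allSubset? : ∀ {n} {P : Subset n → Set} → Decidable P → Dec (∀ S → P S)
allSubset? {n} {P} P? with anySubset? (λ S → ¬? (P? S))
... | yes (S , ¬p) = no (λ f → ¬p (f S))
... | no ¬∃ = yes (λ S → decidable-stable (P? S) (λ ¬p → ¬∃ (S , ¬p)))

countSubsets : ∀ {n} → (Subset n → Bool) → ℕ
countSubsets {zero}  f = if f [] then 1 else 0
countSubsets {suc n} f = countSubsets (f ∘ (inside ∷_)) + countSubsets (f ∘ (outside ∷_))

-- Matroids on the ground set Fin n, via the independence axioms.
-- (Independence is required to be decidable; every predicate on the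
--  finitely many subsets of a finite set is classically decidable.)

record Matroid (n : ℕ) : Set₁ where
  field
    Indep   : Subset n → Set
    indep?  : Decidable Indep
    indep-∅ : Indep ∅
    hered   : ∀ {I J} → J ⊆ I → Indep I → Indep J
    augment : ∀ {I J} → Indep I → Indep J → ∣ I ∣ < ∣ J ∣ →
              ∃[ x ] (x ∈ J × x ∉ I × Indep (⁅ x ⁆ ∪ I))

module _ {n : ℕ} (M : Matroid n) where
  open Matroid M

  IsBasis : Subset n → Set
  IsBasis B = Indep B × (∀ J → B ⊆ J → Indep J → J ⊆ B)

  isBasis? : Decidable IsBasis
  isBasis? B = indep? B ×-dec allSubset? (λ J → (B ⊆? J) →-dec (indep? J →-dec (J ⊆? B)))

  IndepDual : Subset n → Set
  IndepDual I = ∃[ B ] (IsBasis B × I ⊆ ∁ B)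

  indepDual? : Decidable IndepDual
  indepDual? I = anySubset? (λ B → isBasis? B ×-dec (I ⊆? ∁ B))

  IsCircuit : Subset n → Set
  IsCircuit C = ¬ Indep C × (∀ D → D ⊂ C → Indep D)

  isCircuit? : Decidable IsCircuit
  isCircuit? C = ¬? (indep? C) ×-dec allSubset? (λ D → (D ⊂? C) →-dec indep? D)

  IsCocircuit : Subset n → Set
  IsCocircuit C = ¬ IndepDual C × (∀ D → D ⊂ C → IndepDual D)

  isCocircuit? : Decidable IsCocircuit
  isCocircuit? C = ¬? (indepDual? C) ×-dec allSubset? (λ D → (D ⊂? C) →-dec indepDual? D)

  Least : Fin n → Subset n → Set
  Least v C = v ∈ C × (∀ w → w ∈ C → v Fin.≤ w)

  least? : ∀ v C → Dec (Least v C)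
  least? v C = (v ∈? C) ×-dec all? (λ w → (w ∈? C) →-dec (v FinP.≤? w))

  IntActive : Subset n → Fin n → Set
  IntActive B v = v ∈ B × ∃[ C ] (IsCocircuit C × C ⊆ (∁ B ∪ ⁅ v ⁆) × Least v C)

  intActive? : ∀ B v → Dec (IntActive B v)
  intActive? B v = (v ∈? B) ×-dec
    anySubset? (λ C → isCocircuit? C ×-dec ((C ⊆? (∁ B ∪ ⁅ v ⁆)) ×-dec least? v C))

  ExtActive : Subset n → Fin n → Set
  ExtActive B v = v ∉ B × ∃[ C ] (IsCircuit C × C ⊆ (B ∪ ⁅ v ⁆) × Least v C)

  extActive? : ∀ B v → Dec (ExtActive B v)
  extActive? B v = ¬? (v ∈? B) ×-dec
    anySubset? (λ C → isCircuit? C ×-dec ((C ⊆? (B ∪ ⁅ v ⁆)) ×-dec least? v C))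

  int : Subset n → ℕ
  int B = ∣ tabulate (λ v → does (intActive? B v)) ∣

  ext : Subset n → ℕ
  ext B = ∣ tabulate (λ v → does (extActive? B v)) ∣

  -- t_{i,j}: coefficient of x^i y^j in the Tutte polynomial, i.e. the
  -- number of bases B with int(B) = i and ext(B) = j
  TutteCoeff : ℕ → ℕ → ℕ
  TutteCoeff i j =
    countSubsets (λ B → does (isBasis? B) ∧ ((int B ≡ᵇ i) ∧ (ext B ≡ᵇ j)))

  -- For disjoint X, Y ⊆ E, the minor M / X \ Y has ground set
  -- E - (X ∪ Y), and a subset I of it is independent iff I ∪ J is
  -- independent in M for a basis J of M|X (the choice of J is irrelevant).

  IsBasisOf : Subset n → Subset n → Set
  IsBasisOf X J = J ⊆ X × Indep J × (∀ J′ → J ⊆ J′ → J′ ⊆ X → Indep J′ → J′ ⊆ J)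

  MinorIndep : (X : Subset n) → Subset n → Set
  MinorIndep X I = ∃[ J ] (IsBasisOf X J × Indep (I ∪ J))

-- The matroid U_{k,k} ⊕ U_{0,l} on Fin (k + l): the first k elements
-- form U_{k,k}, the last l elements form U_{0,l}.

UniformIndep : (r m : ℕ) → Subset m → Set
UniformIndep r m I = ∣ I ∣ ≤ r

CoLoopsLoopsIndep : (k l : ℕ) → Subset (k + l) → Set
CoLoopsLoopsIndep k l I = UniformIndep k k (take k I) × UniformIndep 0 l (drop k I)

preimage : ∀ {m n} → (Fin m → Fin n) → Subset n → Subset m
preimage φ S = tabulate (λ x → lookup S (φ x))

-- M has a minor isomorphic to U_{k,k} ⊕ U_{0,l}: there are disjoint
-- X (contracted), Y (deleted) and a bijection φ from Fin (k + l) onto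
-- E - (X ∪ Y) carrying independent sets to independent sets (both ways).
HasMinorCoLoopsLoops : ∀ {n} → Matroid n → (k l : ℕ) → Set
HasMinorCoLoopsLoops {n} M k l =
  ∃[ X ] ∃[ Y ] (X ∩ Y ≡ ∅ ×
    ∃[ φ ] (Injective _≡_ _≡_ φ ×
      (∀ y → (y ∈ ∁ (X ∪ Y)) ⇔ (∃[ x ] φ x ≡ y)) ×
      (∀ S → S ⊆ ∁ (X ∪ Y) →
         (MinorIndep M X S ⇔ CoLoopsLoopsIndep k l (preimage {k + l} {n} φ S)))))

IsKLUniform : ∀ {n} → (k l : ℕ) → Matroid n → Set
IsKLUniform k l M = ¬ HasMinorCoLoopsLoops M k l

-- A basis B with k internally active elements f₁ … f_k and l externally active elements
-- g₁ … g_l gives the minor U_{k,k} ⊕ U_{0,l}: contract B ∖ {fᵢ} and delete E ∖ B ∖ {gⱼ}.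
-- No fᵢ lies in the fundamental circuit of any gⱼ (that would put gⱼ in the fundamental
-- cocircuit of fᵢ, and each would be the least element of both), so the gⱼ become loops
-- and the fᵢ coloops.  Conversely, let M / X ∖ Y be such a minor, J a basis of X and L its
-- loops; then A = J ∪ L has rank ∣ J ∣.  Build a basis B greedily, scanning A downwards and
-- then E ∖ A upwards: every element of A ∖ B is then externally active and every element of
-- B ∖ A internally active, and counting gives ∣ B ∖ A ∣ ≥ k and ∣ A ∖ B ∣ ≥ l.  Hence the
-- minor exists iff some basis has int ≥ k and ext ≥ l, i.e. iff some t_{i,j} with i ≥ k,
-- j ≥ l is nonzero.
module Submission where

open import Defs
open import Data.Bool using (Bool; true; false; T)
open import Data.Bool.Properties using (T-∧; T-≡)
open import Data.Empty using (⊥-elim)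
open import Data.Fin as Fin using (Fin; _↑ˡ_; _↑ʳ_; splitAt; join; opposite)
import Data.Fin.Properties as Finₚ
open import Data.Fin.Subset
  using (Subset; inside; outside; _∈_; _∉_; _⊆_; _⊂_; ⁅_⁆; _∪_; _∩_; ∁; ∣_∣; _-_)
  renaming (⊥ to ∅)
open import Data.Fin.Subset.Properties
open import Data.List as List using (List; []; _∷_; allFin)
open import Data.List.Membership.Propositional using () renaming (_∈_ to _∈ₗ_)
open import Data.List.Membership.Propositional.Properties using (∈-allFin; ∈-tabulate⁺)
open import Data.List.Relation.Unary.All as All using ()
import Data.List.Relation.Unary.Any as Any
open import Data.List.Relation.Unary.AllPairs using (AllPairs; _∷_)
open import Data.List.Relation.Unary.AllPairs.Properties using (tabulate⁺-<)
open import Data.Nat as ℕ using (ℕ; zero; suc; _+_; _≤_; _<_; s≤s)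
import Data.Nat.Properties as ℕₚ
open import Data.Product using (Σ; ∃; ∃-syntax; _×_; _,_; proj₁; proj₂)
open import Data.Sum as Sum using (_⊎_; inj₁; inj₂; [_,_]′)
open import Data.Vec using ([]; _∷_; tabulate; lookup; take; drop; here; there)
open import Data.Vec.Properties using (lookup∘tabulate; []=⇒lookup; lookup⇒[]=)
open import Function using (_∘_; id)
open import Function.Bundles using (_⇔_; mk⇔; Equivalence)
open import Function.Definitions using (Injective)
open import Relation.Binary.PropositionalEquality hiding (J)
open import Relation.Nullary using (¬_; Dec; yes; no; does)
open import Relation.Nullary.Decidable using (dec-true; decidable-stable; ¬?; _×-dec_)
open import Relation.Unary using (Decidable)

private
  variable
    m n : ℕ

does-true⇒ : ∀ {P : Set} (P? : Dec P) → does P? ≡ true → P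
does-true⇒ (yes p) _ = p

T-does⇔ : ∀ {P : Set} (P? : Dec P) → T (does P?) ⇔ P
T-does⇔ P? = mk⇔ (does-true⇒ P? ∘ Equivalence.to T-≡) (Equivalence.from T-≡ ∘ dec-true P?)

⟦_⟧ : {Q : Fin n → Set} → Decidable Q → Subset n
⟦ Q? ⟧ = tabulate (does ∘ Q?)

∈⟦⟧⁺ : {Q : Fin n → Set} (Q? : Decidable Q) {x : Fin n} → Q x → x ∈ ⟦ Q? ⟧
∈⟦⟧⁺ Q? {x} q = lookup⇒[]= x _ (trans (lookup∘tabulate _ x) (dec-true (Q? x) q))

∈⟦⟧⁻ : {Q : Fin n → Set} (Q? : Decidable Q) {x : Fin n} → x ∈ ⟦ Q? ⟧ → Q x
∈⟦⟧⁻ Q? {x} x∈ = does-true⇒ (Q? x) (trans (sym (lookup∘tabulate _ x)) ([]=⇒lookup x∈))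

∈-preimage⇔ : (φ : Fin m → Fin n) (S : Subset n) {x : Fin m} → x ∈ preimage φ S ⇔ φ x ∈ S
∈-preimage⇔ φ S {x} = mk⇔
  (λ x∈ → lookup⇒[]= (φ x) S (trans (sym (lookup∘tabulate _ x)) ([]=⇒lookup x∈)))
  (λ φx∈ → lookup⇒[]= x _ (trans (lookup∘tabulate _ x) ([]=⇒lookup φx∈)))

∈-drop⇔ : ∀ k (p : Subset (k + m)) {x : Fin m} → x ∈ drop k p ⇔ k ↑ʳ x ∈ p
∈-drop⇔ zero    p       = mk⇔ id id
∈-drop⇔ (suc k) (b ∷ p) = mk⇔ (there ∘ Equivalence.to (∈-drop⇔ k p))
                               (Equivalence.from (∈-drop⇔ k p) ∘ drop-there)

∣p∣≤0⇒∉ : (p : Subset n) → ∣ p ∣ ≤ 0 → ∀ {x} → x ∉ p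
∣p∣≤0⇒∉ p ∣p∣≤0 x∈p = ℕₚ.n≮0 (ℕₚ.<-≤-trans (x∈p⇒∣p-x∣<∣p∣ x∈p) ∣p∣≤0)

∉⇒∣p∣≤0 : (p : Subset n) → (∀ {x} → x ∉ p) → ∣ p ∣ ≤ 0
∉⇒∣p∣≤0 {n} p ∉p = subst (∣ p ∣ ≤_) (∣⊥∣≡0 n) (p⊆q⇒∣p∣≤∣q∣ {q = ∅} (⊥-elim ∘ ∉p))

coLoopsLoopsIndep-preimage⇔ : ∀ k l (φ : Fin (k + l) → Fin n) (S : Subset n) →
                              CoLoopsLoopsIndep k l (preimage φ S) ⇔ (∀ j → φ (k ↑ʳ j) ∉ S)
coLoopsLoopsIndep-preimage⇔ k l φ S = mk⇔
  (λ (_ , no-loops) j φj∈S →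
     ∣p∣≤0⇒∉ (drop k p) no-loops (from (∈-drop⇔ k p) (from (∈-preimage⇔ φ S) φj∈S)))
  (λ ∉S → ∣p∣≤n (take k p) , ∉⇒∣p∣≤0 (drop k p) (∉S _ ∘ to (∈-preimage⇔ φ S) ∘ to (∈-drop⇔ k p)))
  where
  open Equivalence
  p : Subset (k + l)
  p = preimage φ S

∣p∪q∣≡∣p∣+∣q∣ : (p q : Subset n) → (∀ {x} → x ∈ p → x ∉ q) → ∣ p ∪ q ∣ ≡ ∣ p ∣ + ∣ q ∣
∣p∪q∣≡∣p∣+∣q∣ []            []            _ = refl
∣p∪q∣≡∣p∣+∣q∣ (true  ∷ p) (true  ∷ q) disj = ⊥-elim (disj here here)
∣p∪q∣≡∣p∣+∣q∣ (true  ∷ p) (false ∷ q) disj = cong suc (∣p∪q∣≡∣p∣+∣q∣ p q (λ x∈p x∈q → disj (there x∈p) (there x∈q)))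
∣p∪q∣≡∣p∣+∣q∣ (false ∷ p) (true  ∷ q) disj =
  trans (cong suc (∣p∪q∣≡∣p∣+∣q∣ p q (λ x∈p x∈q → disj (there x∈p) (there x∈q)))) (sym (ℕₚ.+-suc _ _))
∣p∪q∣≡∣p∣+∣q∣ (false ∷ p) (false ∷ q) disj = ∣p∪q∣≡∣p∣+∣q∣ p q (λ x∈p x∈q → disj (there x∈p) (there x∈q))

∣⁅x⁆∪p∣≡1+∣p∣ : (x : Fin n) (p : Subset n) → x ∉ p → ∣ ⁅ x ⁆ ∪ p ∣ ≡ suc ∣ p ∣
∣⁅x⁆∪p∣≡1+∣p∣ x p x∉p =
  trans (∣p∪q∣≡∣p∣+∣q∣ ⁅ x ⁆ p (λ y∈ → subst (_∉ p) (sym (x∈⁅y⁆⇒x≡y x y∈)) x∉p))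
        (cong (_+ ∣ p ∣) (∣⁅x⁆∣≡1 x))

∣p∣≡∣p∩q∣+∣p∩∁q∣ : (p q : Subset n) → ∣ p ∣ ≡ ∣ p ∩ q ∣ + ∣ p ∩ ∁ q ∣
∣p∣≡∣p∩q∣+∣p∩∁q∣ []          []          = refl
∣p∣≡∣p∩q∣+∣p∩∁q∣ (true  ∷ p) (true  ∷ q) = cong suc (∣p∣≡∣p∩q∣+∣p∩∁q∣ p q)
∣p∣≡∣p∩q∣+∣p∩∁q∣ (true  ∷ p) (false ∷ q) = trans (cong suc (∣p∣≡∣p∩q∣+∣p∩∁q∣ p q)) (sym (ℕₚ.+-suc _ _))
∣p∣≡∣p∩q∣+∣p∩∁q∣ (false ∷ p) (_     ∷ q) = ∣p∣≡∣p∩q∣+∣p∩∁q∣ p q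

image : (Fin m → Fin n) → Subset n
image {zero}  f = ∅
image {suc m} f = ⁅ f Fin.zero ⁆ ∪ image (f ∘ Fin.suc)

∈-image⁺ : (f : Fin m → Fin n) (x : Fin m) → f x ∈ image f
∈-image⁺ f Fin.zero    = x∈p∪q⁺ (inj₁ (x∈⁅x⁆ (f Fin.zero)))
∈-image⁺ f (Fin.suc x) = x∈p∪q⁺ (inj₂ (∈-image⁺ (f ∘ Fin.suc) x))

∈-image⁻ : (f : Fin m → Fin n) {y : Fin n} → y ∈ image f → ∃[ x ] f x ≡ y
∈-image⁻ {zero}  f y∈ = ⊥-elim (∉⊥ y∈)
∈-image⁻ {suc m} f y∈ with x∈p∪q⁻ ⁅ f Fin.zero ⁆ _ y∈
... | inj₁ y∈⁅f0⁆ = Fin.zero , sym (x∈⁅y⁆⇒x≡y _ y∈⁅f0⁆)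
... | inj₂ y∈img  with ∈-image⁻ (f ∘ Fin.suc) y∈img
...   | x , fx≡y = Fin.suc x , fx≡y

∣image∣≡ : (f : Fin m → Fin n) → Injective _≡_ _≡_ f → ∣ image f ∣ ≡ m
∣image∣≡ {zero}  {n} f _   = ∣⊥∣≡0 n
∣image∣≡ {suc m}     f inj =
  trans (∣⁅x⁆∪p∣≡1+∣p∣ (f Fin.zero) (image (f ∘ Fin.suc)) f0∉)
        (cong suc (∣image∣≡ (f ∘ Fin.suc) (Finₚ.suc-injective ∘ inj)))
  where
  f0∉ : f Fin.zero ∉ image (f ∘ Fin.suc)
  f0∉ f0∈ with ∈-image⁻ (f ∘ Fin.suc) f0∈
  ... | _ , eq with inj eq
  ... | ()

≤∣p∣⇒injection : (p : Subset n) → m ≤ ∣ p ∣ →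
                 Σ (Fin m → Fin n) λ f → Injective _≡_ _≡_ f × (∀ x → f x ∈ p)
≤∣p∣⇒injection {m = zero}  p           _         = (λ ()) , (λ { {()} }) , (λ ())
≤∣p∣⇒injection {m = suc m} (false ∷ p) m<∣p∣     with ≤∣p∣⇒injection p m<∣p∣
... | f , inj , f∈ = Fin.suc ∘ f , inj ∘ Finₚ.suc-injective , there ∘ f∈
≤∣p∣⇒injection {m = suc m} (true  ∷ p) (s≤s m≤∣p∣) with ≤∣p∣⇒injection p m≤∣p∣
... | f , inj , f∈ = g , g-inj , g∈
  where
  g : Fin (suc m) → Fin _
  g Fin.zero    = Fin.zero
  g (Fin.suc x) = Fin.suc (f x)
  g-inj : Injective _≡_ _≡_ g
  g-inj {Fin.zero}  {Fin.zero}  _  = refl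
  g-inj {Fin.suc a} {Fin.suc b} eq = cong Fin.suc (inj (Finₚ.suc-injective eq))
  g∈ : ∀ x → g x ∈ (true ∷ p)
  g∈ Fin.zero    = here
  g∈ (Fin.suc x) = there (f∈ x)

countSubsets≡0 : (f : Subset n → Bool) → (∀ S → ¬ T (f S)) → countSubsets f ≡ 0
countSubsets≡0 {zero}  f ¬f with f [] in eq
... | false = refl
... | true  = ⊥-elim (¬f [] (subst T (sym eq) _))
countSubsets≡0 {suc n} f ¬f =
  cong₂ _+_ (countSubsets≡0 (f ∘ (inside ∷_)) (¬f ∘ _)) (countSubsets≡0 (f ∘ (outside ∷_)) (¬f ∘ _))

countSubsets≢0 : (f : Subset n → Bool) (S : Subset n) → T (f S) → countSubsets f ≢ 0
countSubsets≢0 {zero}  f [] fS with f []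
... | true = λ ()
countSubsets≢0 {suc n} f (true  ∷ S) fS c≡0 =
  countSubsets≢0 (f ∘ (inside ∷_)) S fS (ℕₚ.m+n≡0⇒m≡0 _ c≡0)
countSubsets≢0 {suc n} f (false ∷ S) fS c≡0 =
  countSubsets≢0 (f ∘ (outside ∷_)) S fS (ℕₚ.m+n≡0⇒n≡0 (countSubsets (f ∘ (inside ∷_))) c≡0)

minimal-counterexample : {P : Subset n → Set} → Decidable P → ∀ E → ¬ P E →
                         ∃[ C ] (C ⊆ E × ¬ P C × (∀ D → D ⊂ C → P D))
minimal-counterexample {n} {P} P? E ¬PE = go (suc ∣ E ∣) E ℕₚ.≤-refl ¬PE
  where
  go : ∀ fuel E → ∣ E ∣ < fuel → ¬ P E → ∃[ C ] (C ⊆ E × ¬ P C × (∀ D → D ⊂ C → P D))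
  go (suc fuel) E (s≤s ∣E∣≤fuel) ¬PE with anySubset? (λ D → (D ⊂? E) ×-dec ¬? (P? D))
  ... | yes (D , D⊂E , ¬PD) =
    let C , C⊆D , min = go fuel D (ℕₚ.<-≤-trans (p⊂q⇒∣p∣<∣q∣ D⊂E) ∣E∣≤fuel) ¬PD
    in C , ⊆-trans C⊆D (p⊂q⇒p⊆q D⊂E) , min
  ... | no ∄D = E , id , ¬PE , λ D D⊂E → decidable-stable (P? D) (λ ¬PD → ∄D (D , D⊂E , ¬PD))

opposite-reverses-< : {i j : Fin n} → i Fin.< j → opposite j Fin.< opposite i
opposite-reverses-< {n} {i} {j} i<j =
  subst₂ ℕ._<_ (sym (Finₚ.opposite-prop j)) (sym (Finₚ.opposite-prop i))
         (ℕₚ.∸-monoʳ-< (s≤s i<j) (Finₚ.toℕ<n j))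

descending : ∀ n → List (Fin n)
descending n = List.tabulate opposite

descending-sorted : AllPairs (λ i j → j Fin.< i) (descending n)
descending-sorted = tabulate⁺-< opposite-reverses-<

∈-descending : (x : Fin n) → x ∈ₗ descending n
∈-descending x = subst (_∈ₗ _) (Finₚ.opposite-involutive x) (∈-tabulate⁺ (opposite x))

allFin-sorted : AllPairs Fin._<_ (allFin n)
allFin-sorted = tabulate⁺-< id

↑ˡ≢↑ʳ : ∀ {k l} (i : Fin k) (j : Fin l) → i ↑ˡ l ≢ k ↑ʳ j
↑ˡ≢↑ʳ {k} {l} i j eq with trans (sym (Finₚ.splitAt-↑ˡ k i l)) (trans (cong (splitAt k) eq) (Finₚ.splitAt-↑ʳ k l j))
... | ()

[_,_]∘splitAt-injective : ∀ {k l} (f : Fin k → Fin n) (g : Fin l → Fin n) →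
  Injective _≡_ _≡_ f → Injective _≡_ _≡_ g → (∀ a b → f a ≢ g b) → Injective _≡_ _≡_ ([ f , g ]′ ∘ splitAt k)
[_,_]∘splitAt-injective {k = k} {l} f g f-inj g-inj f≢g {a} {b} eq = begin
  a                       ≡⟨ Finₚ.join-splitAt k l a ⟨
  join k l (splitAt k a)  ≡⟨ cong (join k l) (sum-injective (splitAt k a) (splitAt k b) eq) ⟩
  join k l (splitAt k b)  ≡⟨ Finₚ.join-splitAt k l b ⟩
  b                       ∎
  where
  open ≡-Reasoning
  sum-injective : ∀ s t → [ f , g ]′ s ≡ [ f , g ]′ t → s ≡ t
  sum-injective (inj₁ a) (inj₁ b) eq = cong inj₁ (f-inj eq)
  sum-injective (inj₂ a) (inj₂ b) eq = cong inj₂ (g-inj eq)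
  sum-injective (inj₁ a) (inj₂ b) eq = ⊥-elim (f≢g a b eq)
  sum-injective (inj₂ a) (inj₁ b) eq = ⊥-elim (f≢g b a (sym eq))

⁅x⁆∪p⊆q : {x : Fin n} {p q : Subset n} → x ∈ q → p ⊆ q → ⁅ x ⁆ ∪ p ⊆ q
⁅x⁆∪p⊆q {x = x} {p} x∈q p⊆q y∈ with x∈p∪q⁻ ⁅ x ⁆ p y∈
... | inj₁ y∈⁅x⁆ = subst (_∈ _) (sym (x∈⁅y⁆⇒x≡y x y∈⁅x⁆)) x∈q
... | inj₂ y∈p   = p⊆q y∈p

module _ (M : Matroid n) where
  open Matroid M

  dependent-mono : ∀ {x D E} → D ⊆ E → ¬ Indep (⁅ x ⁆ ∪ D) → ¬ Indep (⁅ x ⁆ ∪ E)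
  dependent-mono {x} {D} {E} D⊆E dep ind =
    dep (hered (⁅x⁆∪p⊆q (x∈p∪q⁺ (inj₁ (x∈⁅x⁆ x))) (q⊆p∪q ⁅ x ⁆ E ∘ D⊆E)) ind)

  x∉basis⇒dependent : ∀ {B x} → IsBasis M B → x ∉ B → ¬ Indep (⁅ x ⁆ ∪ B)
  x∉basis⇒dependent {B} {x} (_ , maxB) x∉B ind =
    x∉B (maxB (⁅ x ⁆ ∪ B) (q⊆p∪q ⁅ x ⁆ B) ind (x∈p∪q⁺ (inj₁ (x∈⁅x⁆ x))))

  maximal⇒basis : ∀ {B} → Indep B → (∀ {x} → x ∉ B → ¬ Indep (⁅ x ⁆ ∪ B)) → IsBasis M B
  maximal⇒basis {B} iB max = iB , λ J B⊆J iJ {x} x∈J →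
    decidable-stable (x ∈? B) λ x∉B → max x∉B (hered (⁅x⁆∪p⊆q x∈J B⊆J) iJ)

  ∣indep∣≤∣maximal∣ : ∀ {A J} → Indep J → (∀ {x} → x ∈ A → x ∉ J → ¬ Indep (⁅ x ⁆ ∪ J)) →
                      ∀ {I} → Indep I → I ⊆ A → ∣ I ∣ ≤ ∣ J ∣
  ∣indep∣≤∣maximal∣ {A} {J} iJ max {I} iI I⊆A with ∣ J ∣ ℕ.<? ∣ I ∣
  ... | no  ∣J∣≮∣I∣ = ℕₚ.≮⇒≥ ∣J∣≮∣I∣
  ... | yes ∣J∣<∣I∣ with augment iJ iI ∣J∣<∣I∣
  ...   | x , x∈I , x∉J , ind = ⊥-elim (max (I⊆A x∈I) x∉J ind)

  ∣indep∣≤∣basis∣ : ∀ {B I} → IsBasis M B → Indep I → ∣ I ∣ ≤ ∣ B ∣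
  ∣indep∣≤∣basis∣ bB iI = ∣indep∣≤∣maximal∣ (proj₁ bB) (λ _ → x∉basis⇒dependent bB) iI (⊆⊤ {p = _})

  ∣basis∣≤∣indep∣⇒basis : ∀ {B K} → IsBasis M B → Indep K → ∣ B ∣ ≤ ∣ K ∣ → IsBasis M K
  ∣basis∣≤∣indep∣⇒basis {B} {K} bB iK ∣B∣≤∣K∣ = maximal⇒basis iK λ {x} x∉K ind →
    ℕₚ.<⇒≱ (subst (∣ B ∣ <_) (sym (∣⁅x⁆∪p∣≡1+∣p∣ x K x∉K)) (s≤s ∣B∣≤∣K∣)) (∣indep∣≤∣basis∣ bB ind)

module Greedy (M : Matroid n) {P : Fin n → Set} (P? : Decidable P) where
  open Matroid M

  greedy : Subset n → List (Fin n) → Subset n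
  greedy I []       = I
  greedy I (x ∷ xs) with P? x ×-dec indep? (⁅ x ⁆ ∪ I)
  ... | yes _ = greedy (⁅ x ⁆ ∪ I) xs
  ... | no  _ = greedy I xs

  greedy-indep : ∀ {I} xs → Indep I → Indep (greedy I xs)
  greedy-indep         []       iI = iI
  greedy-indep {I = I} (x ∷ xs) iI with P? x ×-dec indep? (⁅ x ⁆ ∪ I)
  ... | yes (_ , ind) = greedy-indep xs ind
  ... | no  _         = greedy-indep xs iI

  ⊆-greedy : ∀ I xs → I ⊆ greedy I xs
  ⊆-greedy I []       = id
  ⊆-greedy I (x ∷ xs) with P? x ×-dec indep? (⁅ x ⁆ ∪ I)
  ... | yes _ = ⊆-greedy (⁅ x ⁆ ∪ I) xs ∘ q⊆p∪q ⁅ x ⁆ I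
  ... | no  _ = ⊆-greedy I xs

  greedy-⊆ : ∀ I xs {y} → y ∈ greedy I xs → y ∈ I ⊎ P y
  greedy-⊆ I []       y∈ = inj₁ y∈
  greedy-⊆ I (x ∷ xs) y∈ with P? x ×-dec indep? (⁅ x ⁆ ∪ I)
  ... | no  _ = greedy-⊆ I xs y∈
  ... | yes (Px , _) with greedy-⊆ (⁅ x ⁆ ∪ I) xs y∈
  ...   | inj₂ Py = inj₂ Py
  ...   | inj₁ y∈⁅x⁆∪I with x∈p∪q⁻ ⁅ x ⁆ I y∈⁅x⁆∪I
  ...     | inj₁ y∈⁅x⁆ = inj₂ (subst P (sym (x∈⁅y⁆⇒x≡y x y∈⁅x⁆)) Px)
  ...     | inj₂ y∈I   = inj₁ y∈I

  -- As xs is sorted by R, R y x says that y is scanned before x.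
  greedy-rejects : {R : Fin n → Fin n → Set} → ∀ I {xs} → AllPairs R xs → ∀ {x} → x ∈ₗ xs → P x →
                   x ∉ greedy I xs →
                   ∃[ D ] (D ⊆ greedy I xs × (∀ {y} → y ∈ D → y ∈ I ⊎ R y x) × ¬ Indep (⁅ x ⁆ ∪ D))
  greedy-rejects I {x₀ ∷ xs} (x₀<xs ∷ sorted) x∈ Px x∉ with P? x₀ ×-dec indep? (⁅ x₀ ⁆ ∪ I)
  greedy-rejects I {x ∷ xs} (_ ∷ _) (Any.here refl) Px x∉ | yes _ =
    ⊥-elim (x∉ (⊆-greedy (⁅ x ⁆ ∪ I) xs (x∈p∪q⁺ (inj₁ (x∈⁅x⁆ x)))))
  greedy-rejects I {x ∷ xs} (_ ∷ _) (Any.here refl) Px x∉ | no ¬kept =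
    I , ⊆-greedy I xs , inj₁ , λ ind → ¬kept (Px , ind)
  greedy-rejects I (_ ∷ sorted) (Any.there x∈) Px x∉ | no _ = greedy-rejects I sorted x∈ Px x∉
  greedy-rejects {R} I {x₀ ∷ xs} (x₀<xs ∷ sorted) {x} (Any.there x∈) Px x∉ | yes _
    with greedy-rejects (⁅ x₀ ⁆ ∪ I) sorted x∈ Px x∉
  ... | D , D⊆ , D-before , dep = D , D⊆ , before , dep
    where
    before : ∀ {y} → y ∈ D → y ∈ I ⊎ R y x
    before y∈D with D-before y∈D
    ... | inj₂ Ryx = inj₂ Ryx
    ... | inj₁ y∈⁅x₀⁆∪I with x∈p∪q⁻ ⁅ x₀ ⁆ I y∈⁅x₀⁆∪I
    ...   | inj₂ y∈I   = inj₁ y∈I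
    ...   | inj₁ y∈⁅x₀⁆ = inj₂ (subst (λ z → R z x) (sym (x∈⁅y⁆⇒x≡y x₀ y∈⁅x₀⁆)) (All.lookup x₀<xs x∈))

  greedy-maximal : {R : Fin n → Fin n → Set} → ∀ I {xs} → AllPairs R xs → ∀ {x} → x ∈ₗ xs → P x →
                   x ∉ greedy I xs → ¬ Indep (⁅ x ⁆ ∪ greedy I xs)
  greedy-maximal I sorted x∈ Px x∉ =
    let _ , D⊆ , _ , dep = greedy-rejects I sorted x∈ Px x∉ in dependent-mono M D⊆ dep

module _ (M : Matroid n) where
  open Matroid M

  extend-to-basis : ∀ {B I} → IsBasis M B → Indep I → ∃[ K ] (IsBasis M K × I ⊆ K × K ⊆ I ∪ B)
  extend-to-basis {B} {I} bB iI = K , K-basis , ⊆-greedy I (allFin n) , K⊆I∪B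
    where
    open Greedy M (_∈? B)
    K : Subset n
    K = greedy I (allFin n)
    iK : Indep K
    iK = greedy-indep (allFin n) iI
    K-basis : IsBasis M K
    K-basis = ∣basis∣≤∣indep∣⇒basis M bB iK
      (∣indep∣≤∣maximal∣ M iK (λ x∈B → greedy-maximal I allFin-sorted (∈-allFin _) x∈B) (proj₁ bB) id)
    K⊆I∪B : K ⊆ I ∪ B
    K⊆I∪B = x∈p∪q⁺ ∘ greedy-⊆ I (allFin n)

  -- Half of the symmetry u ∈ C(B, v) ⇔ v ∈ C*(B, u) of fundamental circuits and cocircuits.
  fundamental-circuit-cocircuit : ∀ {B C C* u v} → IsBasis M B →
    IsCircuit M C → C ⊆ B ∪ ⁅ v ⁆ → u ∈ C → ¬ IndepDual M C* → C* ⊆ ∁ B ∪ ⁅ u ⁆ → v ∈ C*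
  fundamental-circuit-cocircuit {B} {C} {C*} {u} {v} bB (C-dep , C-min) C⊆B+v u∈C C*-dep C*⊆∁B+u
    with extend-to-basis bB (C-min (C - u) (x∈p⇒p-x⊂p u∈C))
  ... | K , K-basis , C-u⊆K , K⊆C-u∪B =
    decidable-stable (v ∈? C*) λ v∉C* → C*-dep (K , K-basis , x∉p⇒x∈∁p ∘ C*-avoids-K v∉C*)
    where
    u∉K : u ∉ K
    u∉K u∈K = C-dep (hered C⊆K (proj₁ K-basis))
      where
      C⊆K : C ⊆ K
      C⊆K {w} w∈C with w Finₚ.≟ u
      ... | yes refl = u∈K
      ... | no  w≢u  = C-u⊆K (x∈p∧x≢y⇒x∈p-y w∈C w≢u)
    C*-avoids-K : v ∉ C* → ∀ {w} → w ∈ C* → w ∉ K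
    C*-avoids-K v∉C* {w} w∈C* w∈K with x∈p∪q⁻ (∁ B) ⁅ u ⁆ (C*⊆∁B+u w∈C*)
    ... | inj₂ w∈⁅u⁆ = u∉K (subst (_∈ K) (x∈⁅y⁆⇒x≡y u w∈⁅u⁆) w∈K)
    ... | inj₁ w∈∁B with x∈p∪q⁻ (C - u) B (K⊆C-u∪B w∈K)
    ...   | inj₂ w∈B   = x∈∁p⇒x∉p w∈∁B w∈B
    ...   | inj₁ w∈C-u with x∈p∪q⁻ B ⁅ v ⁆ (C⊆B+v (p─q⊆p C ⁅ u ⁆ w∈C-u))
    ...     | inj₁ w∈B   = x∈∁p⇒x∉p w∈∁B w∈B
    ...     | inj₂ w∈⁅v⁆ = v∉C* (subst (_∈ C*) (x∈⁅y⁆⇒x≡y v w∈⁅v⁆) w∈C*)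

  minimal-counterexample-with-least : {P : Subset n → Set} → Decidable P → ∀ {Q D x} →
    (∀ {C} → C ⊆ Q → P C) → D ⊆ Q → (∀ {y} → y ∈ D → x Fin.< y) → ¬ P (⁅ x ⁆ ∪ D) →
    ∃[ C ] ((¬ P C × (∀ E → E ⊂ C → P E)) × C ⊆ Q ∪ ⁅ x ⁆ × Least M x C)
  minimal-counterexample-with-least P? {Q} {D} {x} P-below-Q D⊆Q x<D ¬P
    with minimal-counterexample P? (⁅ x ⁆ ∪ D) ¬P
  ... | C , C⊆x+D , ¬PC , C-min = C , (¬PC , C-min) , C⊆Q+x , x∈C , x≤C
    where
    x-or-D : ∀ {w} → w ∈ C → w ≡ x ⊎ w ∈ D
    x-or-D w∈C = Sum.map₁ (x∈⁅y⁆⇒x≡y x) (x∈p∪q⁻ ⁅ x ⁆ D (C⊆x+D w∈C))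
    C⊆Q+x : C ⊆ Q ∪ ⁅ x ⁆
    C⊆Q+x w∈C = x∈p∪q⁺ ([ (λ { refl → inj₂ (x∈⁅x⁆ x) }) , inj₁ ∘ D⊆Q ]′ (x-or-D w∈C))
    x∈C : x ∈ C
    x∈C = decidable-stable (x ∈? C) λ x∉C →
      ¬PC (P-below-Q λ w∈C → [ (λ { refl → ⊥-elim (x∉C w∈C) }) , D⊆Q ]′ (x-or-D w∈C))
    x≤C : ∀ w → w ∈ C → x Fin.≤ w
    x≤C w w∈C = [ (λ w≡x → Finₚ.≤-reflexive (sym w≡x)) , ℕₚ.<⇒≤ ∘ x<D ]′ (x-or-D w∈C)

  extActive-of-dependent-above : ∀ {B D v} → Indep B → v ∉ B → D ⊆ B →
    (∀ {y} → y ∈ D → v Fin.< y) → ¬ Indep (⁅ v ⁆ ∪ D) → ExtActive M B v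
  extActive-of-dependent-above iB v∉B D⊆B v<D dep =
    v∉B , minimal-counterexample-with-least indep? (λ C⊆B → hered C⊆B iB) D⊆B v<D dep

  intActive-of-codependent-above : ∀ {B D u} → IsBasis M B → u ∈ B → D ⊆ ∁ B →
    (∀ {y} → y ∈ D → u Fin.< y) → ¬ IndepDual M (⁅ u ⁆ ∪ D) → IntActive M B u
  intActive-of-codependent-above {B} bB u∈B D⊆∁B u<D codep =
    u∈B , minimal-counterexample-with-least (indepDual? M) (λ C⊆∁B → B , bB , C⊆∁B) D⊆∁B u<D codep

  intActive∉extActive-circuit : ∀ {B C u v} → IsBasis M B → IntActive M B u →
    v ∉ B → IsCircuit M C → C ⊆ B ∪ ⁅ v ⁆ → Least M v C → u ∉ C
  intActive∉extActive-circuit {B} {C} {u} {v} bB (u∈B , C* , (C*-dep , _) , C*⊆∁B+u , _ , u≤C*)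
                              v∉B C-circuit C⊆B+v (_ , v≤C) u∈C =
    v∉B (subst (_∈ _) (Finₚ.≤-antisym (u≤C* _ v∈C*) (v≤C _ u∈C)) u∈B)
    where
    v∈C* : v ∈ C*
    v∈C* = fundamental-circuit-cocircuit bB C-circuit C⊆B+v u∈C C*-dep C*⊆∁B+u

module ActiveBasis (M : Matroid n) (A : Subset n) where
  open Matroid M
  private
    module Inside  = Greedy M (_∈? A)
    module Outside = Greedy M (λ x → ¬? (x ∈? A))

  B₁ : Subset n
  B₁ = Inside.greedy ∅ (descending n)

  B : Subset n
  B = Outside.greedy B₁ (allFin n)

  B-indep : Indep B
  B-indep = Outside.greedy-indep (allFin n) (Inside.greedy-indep (descending n) indep-∅)

  B₁⊆A : B₁ ⊆ A
  B₁⊆A = [ ⊥-elim ∘ ∉⊥ , id ]′ ∘ Inside.greedy-⊆ ∅ (descending n)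

  B₁⊆B : B₁ ⊆ B
  B₁⊆B = Outside.⊆-greedy B₁ (allFin n)

  rejected-in-A : ∀ {x} → x ∈ A → x ∉ B →
                  ∃[ D ] (D ⊆ B₁ × (∀ {y} → y ∈ D → x Fin.< y) × ¬ Indep (⁅ x ⁆ ∪ D))
  rejected-in-A x∈A x∉B
    with Inside.greedy-rejects ∅ descending-sorted (∈-descending _) x∈A (x∉B ∘ B₁⊆B)
  ... | D , D⊆B₁ , D-before , dep = D , D⊆B₁ , [ ⊥-elim ∘ ∉⊥ , id ]′ ∘ D-before , dep

  rejected-outside-A : ∀ {x} → x ∉ A → x ∉ B →
                       ∃[ D ] (D ⊆ B × (∀ {y} → y ∈ D → y ∈ B₁ ⊎ y Fin.< x) × ¬ Indep (⁅ x ⁆ ∪ D))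
  rejected-outside-A x∉A x∉B = Outside.greedy-rejects B₁ allFin-sorted (∈-allFin _) x∉A x∉B

  B-basis : IsBasis M B
  B-basis = maximal⇒basis M B-indep dependent-on-B
    where
    dependent-on-B : ∀ {x} → x ∉ B → ¬ Indep (⁅ x ⁆ ∪ B)
    dependent-on-B {x} x∉B with x ∈? A
    ... | yes x∈A = let _ , D⊆B₁ , _ , dep = rejected-in-A x∈A x∉B in dependent-mono M (B₁⊆B ∘ D⊆B₁) dep
    ... | no  x∉A = let _ , D⊆B , _ , dep = rejected-outside-A x∉A x∉B in dependent-mono M D⊆B dep

  extActive-on-A∖B : ∀ {v} → v ∈ A → v ∉ B → ExtActive M B v
  extActive-on-A∖B v∈A v∉B =
    let _ , D⊆B₁ , v<D , dep = rejected-in-A v∈A v∉B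
    in extActive-of-dependent-above M B-indep v∉B (B₁⊆B ∘ D⊆B₁) v<D dep

  module _ {u} (u∈B : u ∈ B) (u∉A : u ∉ A) where

    below-u-depends-on-B-u : ∀ {x} → x ∉ B → x Fin.< u → ¬ Indep (⁅ x ⁆ ∪ (B - u))
    below-u-depends-on-B-u {x} x∉B x<u with x ∈? A
    ... | yes x∈A = let _ , D⊆B₁ , _ , dep = rejected-in-A x∈A x∉B in
      dependent-mono M (λ y∈D → x∈p∧x≢y⇒x∈p-y (B₁⊆B (D⊆B₁ y∈D)) (λ { refl → u∉A (B₁⊆A (D⊆B₁ y∈D)) })) dep
    ... | no  x∉A = let _ , D⊆B , D-before , dep = rejected-outside-A x∉A x∉B in
      dependent-mono M (λ y∈D → x∈p∧x≢y⇒x∈p-y (D⊆B y∈D) (λ { refl → u-not-before (D-before y∈D) })) dep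
      where
      u-not-before : ¬ (u ∈ B₁ ⊎ u Fin.< x)
      u-not-before = [ u∉A ∘ B₁⊆A , Finₚ.<-asym x<u ]′

    Above : Subset n
    Above = ∁ B ∩ ⟦ u Fin.<?_ ⟧

    u+Above-codependent : ¬ IndepDual M (⁅ u ⁆ ∪ Above)
    u+Above-codependent (B′ , B′-basis , u+Above⊆∁B′) =
      ℕₚ.<⇒≱ (x∈p⇒∣p-x∣<∣p∣ u∈B)
        (ℕₚ.≤-trans (∣indep∣≤∣basis∣ M B′-basis B-indep)
                    (∣indep∣≤∣maximal∣ M (hered (p─q⊆p B ⁅ u ⁆) B-indep) spans (proj₁ B′-basis) id))
      where
      spans : ∀ {x} → x ∈ B′ → x ∉ B - u → ¬ Indep (⁅ x ⁆ ∪ (B - u))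
      spans {x} x∈B′ x∉B-u = below-u-depends-on-B-u x∉B x<u
        where
        x∉u+Above : x ∉ ⁅ u ⁆ ∪ Above
        x∉u+Above x∈ = x∈∁p⇒x∉p (u+Above⊆∁B′ x∈) x∈B′
        x≢u : x ≢ u
        x≢u refl = x∉u+Above (x∈p∪q⁺ (inj₁ (x∈⁅x⁆ u)))
        x∉B : x ∉ B
        x∉B x∈B = x∉B-u (x∈p∧x≢y⇒x∈p-y x∈B x≢u)
        x<u : x Fin.< u
        x<u = Finₚ.≤∧≢⇒< (ℕₚ.≮⇒≥ λ u<x →
          x∉u+Above (x∈p∪q⁺ (inj₂ (x∈p∩q⁺ (x∉p⇒x∈∁p x∉B , ∈⟦⟧⁺ (u Fin.<?_) u<x))))) x≢u

    intActive-on-B∖A : IntActive M B u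
    intActive-on-B∖A = intActive-of-codependent-above M B-basis u∈B (proj₁ ∘ x∈p∩q⁻ (∁ B) _)
      (λ y∈ → ∈⟦⟧⁻ (u Fin.<?_) (proj₂ (x∈p∩q⁻ (∁ B) _ y∈))) u+Above-codependent

module MinorOfActiveBasis (M : Matroid n) {B : Subset n} (B-basis : IsBasis M B) {k l : ℕ}
  (f : Fin k → Fin n) (f-injective : Injective _≡_ _≡_ f) (f-active : ∀ a → IntActive M B (f a))
  (g : Fin l → Fin n) (g-injective : Injective _≡_ _≡_ g) (g-active : ∀ b → ExtActive M B (g b))
  where
  open Matroid M

  f∈B : ∀ a → f a ∈ B
  f∈B = proj₁ ∘ f-active

  g∉B : ∀ b → g b ∉ B
  g∉B = proj₁ ∘ g-active

  X Y : Subset n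
  X = B ∩ ∁ (image f)
  Y = ∁ B ∩ ∁ (image g)

  X∩Y≡∅ : X ∩ Y ≡ ∅
  X∩Y≡∅ = ⊆-antisym (λ x∈X∩Y → let x∈X , x∈Y = x∈p∩q⁻ X Y x∈X∩Y in
            ⊥-elim (x∈∁p⇒x∉p (proj₁ (x∈p∩q⁻ (∁ B) _ x∈Y)) (proj₁ (x∈p∩q⁻ B _ x∈X)))) ⊥⊆

  X-indep : Indep X
  X-indep = hered (p∩q⊆p B _) (proj₁ B-basis)

  φ : Fin (k + l) → Fin n
  φ = [ f , g ]′ ∘ splitAt k

  φ-injective : Injective _≡_ _≡_ φ
  φ-injective = [ f , g ]∘splitAt-injective f-injective g-injective
    λ a b fa≡gb → g∉B b (subst (_∈ B) fa≡gb (f∈B a))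

  φ-image : ∀ y → (y ∈ ∁ (X ∪ Y)) ⇔ (∃[ x ] φ x ≡ y)
  φ-image y = mk⇔ onto (λ (x , φx≡y) → x∉p⇒x∈∁p (subst (_∉ X ∪ Y) φx≡y (values-outside (splitAt k x))))
    where
    values-outside : ∀ s → [ f , g ]′ s ∉ X ∪ Y
    values-outside (inj₁ a) fa∈X∪Y with x∈p∪q⁻ X Y fa∈X∪Y
    ... | inj₁ fa∈X = x∈∁p⇒x∉p (proj₂ (x∈p∩q⁻ B _ fa∈X)) (∈-image⁺ f a)
    ... | inj₂ fa∈Y = x∈∁p⇒x∉p (proj₁ (x∈p∩q⁻ (∁ B) _ fa∈Y)) (f∈B a)
    values-outside (inj₂ b) gb∈X∪Y with x∈p∪q⁻ X Y gb∈X∪Y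
    ... | inj₁ gb∈X = g∉B b (proj₁ (x∈p∩q⁻ B _ gb∈X))
    ... | inj₂ gb∈Y = x∈∁p⇒x∉p (proj₂ (x∈p∩q⁻ (∁ B) _ gb∈Y)) (∈-image⁺ g b)
    onto : y ∈ ∁ (X ∪ Y) → ∃[ x ] φ x ≡ y
    onto y∉X∪Y with y ∈? B
    ... | yes y∈B = let a , fa≡y = ∈-image⁻ f (decidable-stable (y ∈? image f) λ y∉img →
                                     x∈∁p⇒x∉p y∉X∪Y (x∈p∪q⁺ (inj₁ (x∈p∩q⁺ (y∈B , x∉p⇒x∈∁p y∉img)))))
                    in a ↑ˡ l , trans (cong [ f , g ]′ (Finₚ.splitAt-↑ˡ k a l)) fa≡y
    ... | no  y∉B = let b , gb≡y = ∈-image⁻ g (decidable-stable (y ∈? image g) λ y∉img →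
                                     x∈∁p⇒x∉p y∉X∪Y (x∈p∪q⁺ (inj₂ (x∈p∩q⁺ (x∉p⇒x∈∁p y∉B , x∉p⇒x∈∁p y∉img)))))
                    in k ↑ʳ b , trans (cong [ f , g ]′ (Finₚ.splitAt-↑ʳ k l b)) gb≡y

  minorIndep⇔loop-free : ∀ S → S ⊆ ∁ (X ∪ Y) → MinorIndep M X S ⇔ (∀ b → g b ∉ S)
  minorIndep⇔loop-free S S⊆ = mk⇔ loop-free minorIndep
    where
    loop-free : MinorIndep M X S → ∀ b → g b ∉ S
    loop-free (J , (J⊆X , _ , J-max) , S∪J-indep) b gb∈S with g-active b
    ... | _ , C , C-circuit , C⊆B+gb , gb-least = proj₁ C-circuit (hered C⊆S∪J S∪J-indep)
      where
      X⊆J : X ⊆ J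
      X⊆J = J-max X J⊆X id X-indep
      C⊆S∪J : C ⊆ S ∪ J
      C⊆S∪J {c} c∈C with x∈p∪q⁻ B ⁅ g b ⁆ (C⊆B+gb c∈C)
      ... | inj₂ c∈⁅gb⁆ = x∈p∪q⁺ (inj₁ (subst (_∈ S) (sym (x∈⁅y⁆⇒x≡y (g b) c∈⁅gb⁆)) gb∈S))
      ... | inj₁ c∈B    = x∈p∪q⁺ (inj₂ (X⊆J (x∈p∩q⁺ (c∈B , x∉p⇒x∈∁p c∉image))))
        where
        c∉image : c ∉ image f
        c∉image c∈image = let a , fa≡c = ∈-image⁻ f c∈image in
          intActive∉extActive-circuit M B-basis (f-active a) (g∉B b) C-circuit C⊆B+gb gb-least
            (subst (_∈ C) (sym fa≡c) c∈C)
    minorIndep : (∀ b → g b ∉ S) → MinorIndep M X S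
    minorIndep g∉S = X , (id , X-indep , λ _ _ J′⊆X _ → J′⊆X) , hered S∪X⊆B (proj₁ B-basis)
      where
      S∪X⊆B : S ∪ X ⊆ B
      S∪X⊆B {s} s∈ with x∈p∪q⁻ S X s∈
      ... | inj₂ s∈X = proj₁ (x∈p∩q⁻ B _ s∈X)
      ... | inj₁ s∈S = decidable-stable (s ∈? B) λ s∉B →
        let b , gb≡s = ∈-image⁻ g (decidable-stable (s ∈? image g) λ s∉img →
                          x∈∁p⇒x∉p (S⊆ s∈S) (x∈p∪q⁺ (inj₂ (x∈p∩q⁺ (x∉p⇒x∈∁p s∉B , x∉p⇒x∈∁p s∉img)))))
        in g∉S b (subst (_∈ S) (sym gb≡s) s∈S)

  φ-↑ʳ : ∀ b → φ (k ↑ʳ b) ≡ g b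
  φ-↑ʳ b = cong [ f , g ]′ (Finₚ.splitAt-↑ʳ k l b)

  φ-iso : ∀ S → S ⊆ ∁ (X ∪ Y) → MinorIndep M X S ⇔ CoLoopsLoopsIndep k l (preimage φ S)
  φ-iso S S⊆ = mk⇔
    (λ indep → from coLoops⇔ λ b → subst (_∉ S) (sym (φ-↑ʳ b)) (to minor⇔ indep b))
    (λ indep → from minor⇔ λ b → subst (_∉ S) (φ-↑ʳ b) (to coLoops⇔ indep b))
    where
    open Equivalence
    minor⇔ : MinorIndep M X S ⇔ (∀ b → g b ∉ S)
    minor⇔ = minorIndep⇔loop-free S S⊆
    coLoops⇔ : CoLoopsLoopsIndep k l (preimage φ S) ⇔ (∀ b → φ (k ↑ʳ b) ∉ S)
    coLoops⇔ = coLoopsLoopsIndep-preimage⇔ k l φ S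

  hasMinor : HasMinorCoLoopsLoops M k l
  hasMinor = X , Y , X∩Y≡∅ , φ , φ-injective , φ-image , φ-iso

minor-of-active-basis : (M : Matroid n) {B : Subset n} → IsBasis M B →
                        ∀ {k l} → k ≤ int M B → l ≤ ext M B → HasMinorCoLoopsLoops M k l
minor-of-active-basis M {B} B-basis k≤int l≤ext =
  let f , f-injective , f∈ = ≤∣p∣⇒injection ⟦ intActive? M B ⟧ k≤int
      g , g-injective , g∈ = ≤∣p∣⇒injection ⟦ extActive? M B ⟧ l≤ext
  in MinorOfActiveBasis.hasMinor M B-basis f f-injective (∈⟦⟧⁻ (intActive? M B) ∘ f∈)
                                           g g-injective (∈⟦⟧⁻ (extActive? M B) ∘ g∈)

module ActiveBasisOfMinor (M : Matroid n) {k l : ℕ} (X Y : Subset n) (φ : Fin (k + l) → Fin n)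
  (φ-injective : Injective _≡_ _≡_ φ)
  (φ-image : ∀ y → (y ∈ ∁ (X ∪ Y)) ⇔ (∃[ x ] φ x ≡ y))
  (φ-iso : ∀ S → S ⊆ ∁ (X ∪ Y) → MinorIndep M X S ⇔ CoLoopsLoopsIndep k l (preimage φ S))
  where
  open Matroid M

  coloop : Fin k → Fin n
  coloop a = φ (a ↑ˡ l)

  loop : Fin l → Fin n
  loop b = φ (k ↑ʳ b)

  K L : Subset n
  K = image coloop
  L = image loop

  φ∈∁X∪Y : ∀ x → φ x ∈ ∁ (X ∪ Y)
  φ∈∁X∪Y x = Equivalence.from (φ-image (φ x)) (x , refl)

  image-φ⊆∁X∪Y : ∀ {m} (ψ : Fin m → Fin (k + l)) → image (φ ∘ ψ) ⊆ ∁ (X ∪ Y)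
  image-φ⊆∁X∪Y ψ y∈ = let x , φψx≡y = ∈-image⁻ (φ ∘ ψ) y∈ in subst (_∈ ∁ (X ∪ Y)) φψx≡y (φ∈∁X∪Y (ψ x))

  image-φ-disjoint-X : ∀ {m} (ψ : Fin m → Fin (k + l)) {y} → y ∈ image (φ ∘ ψ) → y ∉ X
  image-φ-disjoint-X ψ y∈ y∈X = x∈∁p⇒x∉p (image-φ⊆∁X∪Y ψ y∈) (x∈p∪q⁺ (inj₁ y∈X))

  K-minorIndep : MinorIndep M X K
  K-minorIndep = Equivalence.from (φ-iso K (image-φ⊆∁X∪Y (_↑ˡ l)))
    (Equivalence.from (coLoopsLoopsIndep-preimage⇔ k l φ K) λ b loop∈K →
       let a , eq = ∈-image⁻ coloop loop∈K in ↑ˡ≢↑ʳ a b (φ-injective eq))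

  J : Subset n
  J = proj₁ K-minorIndep

  J-basisOf : IsBasisOf M X J
  J-basisOf = proj₁ (proj₂ K-minorIndep)

  J⊆X : J ⊆ X
  J⊆X = proj₁ J-basisOf

  J-indep : Indep J
  J-indep = proj₁ (proj₂ J-basisOf)

  K∪J-indep : Indep (K ∪ J)
  K∪J-indep = proj₂ (proj₂ K-minorIndep)

  loop-dependent : ∀ b → ¬ Indep (⁅ loop b ⁆ ∪ J)
  loop-dependent b ind =
    Equivalence.to (coLoopsLoopsIndep-preimage⇔ k l φ ⁅ loop b ⁆)
      (Equivalence.to (φ-iso ⁅ loop b ⁆ ⁅loop⁆⊆∁X∪Y) (J , J-basisOf , ind)) b (x∈⁅x⁆ (loop b))
    where
    ⁅loop⁆⊆∁X∪Y : ⁅ loop b ⁆ ⊆ ∁ (X ∪ Y)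
    ⁅loop⁆⊆∁X∪Y y∈ = subst (_∈ ∁ (X ∪ Y)) (sym (x∈⁅y⁆⇒x≡y (loop b) y∈)) (φ∈∁X∪Y (k ↑ʳ b))

  A : Subset n
  A = J ∪ L

  ∣indep⊆A∣≤∣J∣ : ∀ {I} → Indep I → I ⊆ A → ∣ I ∣ ≤ ∣ J ∣
  ∣indep⊆A∣≤∣J∣ = ∣indep∣≤∣maximal∣ M J-indep spans
    where
    spans : ∀ {x} → x ∈ A → x ∉ J → ¬ Indep (⁅ x ⁆ ∪ J)
    spans x∈A x∉J with x∈p∪q⁻ J L x∈A
    ... | inj₁ x∈J = ⊥-elim (x∉J x∈J)
    ... | inj₂ x∈L = let b , loop-b≡x = ∈-image⁻ loop x∈L in
                     subst (λ z → ¬ Indep (⁅ z ⁆ ∪ J)) loop-b≡x (loop-dependent b)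

  ∣K∣≡k : ∣ K ∣ ≡ k
  ∣K∣≡k = ∣image∣≡ coloop (Finₚ.↑ˡ-injective l _ _ ∘ φ-injective)

  ∣L∣≡l : ∣ L ∣ ≡ l
  ∣L∣≡l = ∣image∣≡ loop (Finₚ.↑ʳ-injective k _ _ ∘ φ-injective)

  open ActiveBasis M A public

  k≤∣B∖A∣ : k ≤ ∣ B ∩ ∁ A ∣
  k≤∣B∖A∣ = ℕₚ.+-cancelʳ-≤ ∣ J ∣ k (∣ B ∩ ∁ A ∣) (begin
    k + ∣ J ∣               ≡⟨ cong (_+ ∣ J ∣) ∣K∣≡k ⟨
    ∣ K ∣ + ∣ J ∣           ≡⟨ ∣p∪q∣≡∣p∣+∣q∣ K J (λ y∈K → image-φ-disjoint-X (_↑ˡ l) y∈K ∘ J⊆X) ⟨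
    ∣ K ∪ J ∣               ≤⟨ ∣indep∣≤∣basis∣ M B-basis K∪J-indep ⟩
    ∣ B ∣                   ≡⟨ ∣p∣≡∣p∩q∣+∣p∩∁q∣ B A ⟩
    ∣ B ∩ A ∣ + ∣ B ∩ ∁ A ∣ ≤⟨ ℕₚ.+-monoˡ-≤ _ (∣indep⊆A∣≤∣J∣ (hered (p∩q⊆p B A) B-indep) (p∩q⊆q B A)) ⟩
    ∣ J ∣ + ∣ B ∩ ∁ A ∣     ≡⟨ ℕₚ.+-comm ∣ J ∣ _ ⟩
    ∣ B ∩ ∁ A ∣ + ∣ J ∣     ∎)
    where open ℕₚ.≤-Reasoning

  l≤∣A∖B∣ : l ≤ ∣ A ∩ ∁ B ∣
  l≤∣A∖B∣ = ℕₚ.+-cancelʳ-≤ ∣ J ∣ l (∣ A ∩ ∁ B ∣) (begin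
    l + ∣ J ∣               ≡⟨ ℕₚ.+-comm l ∣ J ∣ ⟩
    ∣ J ∣ + l               ≡⟨ cong (∣ J ∣ +_) ∣L∣≡l ⟨
    ∣ J ∣ + ∣ L ∣           ≡⟨ ∣p∪q∣≡∣p∣+∣q∣ J L (λ y∈J y∈L → image-φ-disjoint-X (k ↑ʳ_) y∈L (J⊆X y∈J)) ⟨
    ∣ A ∣                   ≡⟨ ∣p∣≡∣p∩q∣+∣p∩∁q∣ A B ⟩
    ∣ A ∩ B ∣ + ∣ A ∩ ∁ B ∣ ≤⟨ ℕₚ.+-monoˡ-≤ _ (∣indep⊆A∣≤∣J∣ (hered (p∩q⊆q A B) B-indep) (p∩q⊆p A B)) ⟩
    ∣ J ∣ + ∣ A ∩ ∁ B ∣     ≡⟨ ℕₚ.+-comm ∣ J ∣ _ ⟩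
    ∣ A ∩ ∁ B ∣ + ∣ J ∣     ∎)
    where open ℕₚ.≤-Reasoning

  k≤int : k ≤ int M B
  k≤int = ℕₚ.≤-trans k≤∣B∖A∣ (p⊆q⇒∣p∣≤∣q∣ λ u∈ →
    let u∈B , u∈∁A = x∈p∩q⁻ B (∁ A) u∈ in ∈⟦⟧⁺ (intActive? M B) (intActive-on-B∖A u∈B (x∈∁p⇒x∉p u∈∁A)))

  l≤ext : l ≤ ext M B
  l≤ext = ℕₚ.≤-trans l≤∣A∖B∣ (p⊆q⇒∣p∣≤∣q∣ λ v∈ →
    let v∈A , v∈∁B = x∈p∩q⁻ A (∁ B) v∈ in ∈⟦⟧⁺ (extActive? M B) (extActive-on-A∖B v∈A (x∈∁p⇒x∉p v∈∁B)))

active-basis-of-minor : (M : Matroid n) {k l : ℕ} → HasMinorCoLoopsLoops M k l →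
                        ∃[ B ] (IsBasis M B × k ≤ int M B × l ≤ ext M B)
active-basis-of-minor M (X , Y , _ , φ , φ-injective , φ-image , φ-iso) = B , B-basis , k≤int , l≤ext
  where open ActiveBasisOfMinor M X Y φ φ-injective φ-image φ-iso

TutteCoeff≡0 : (M : Matroid n) {i j : ℕ} →
               (∀ B → ¬ (IsBasis M B × int M B ≡ i × ext M B ≡ j)) → TutteCoeff M i j ≡ 0
TutteCoeff≡0 M {i} {j} no-basis = countSubsets≡0 _ λ B counted →
  let basis , activities = Equivalence.to T-∧ counted
      int≡i , ext≡j      = Equivalence.to T-∧ activities
  in no-basis B ( Equivalence.to (T-does⇔ (isBasis? M B)) basis
                , ℕₚ.≡ᵇ⇒≡ (int M B) i int≡i
                , ℕₚ.≡ᵇ⇒≡ (ext M B) j ext≡j )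

TutteCoeff-basis≢0 : (M : Matroid n) {B : Subset n} → IsBasis M B → TutteCoeff M (int M B) (ext M B) ≢ 0
TutteCoeff-basis≢0 M {B} B-basis = countSubsets≢0 _ B
  (Equivalence.from T-∧ ( Equivalence.from (T-does⇔ (isBasis? M B)) B-basis
                        , Equivalence.from T-∧ (ℕₚ.≡⇒≡ᵇ (int M B) _ refl , ℕₚ.≡⇒≡ᵇ (ext M B) _ refl)))

theorem1p1 : (k l : ℕ) → 1 ≤ k → 1 ≤ l → {n : ℕ} (M : Matroid n) →
    IsKLUniform k l M ⇔ (∀ i j → k ≤ i → l ≤ j → TutteCoeff M i j ≡ 0)
theorem1p1 k l _ _ M = mk⇔
  (λ no-minor i j k≤i l≤j → TutteCoeff≡0 M λ { B (B-basis , refl , refl) →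
     no-minor (minor-of-active-basis M B-basis k≤i l≤j) })
  (λ vanishing minor →
     let B , B-basis , k≤int , l≤ext = active-basis-of-minor M minor
     in TutteCoeff-basis≢0 M B-basis (vanishing _ _ k≤int l≤ext))
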